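{- Let $M_2=K_2$ and $M_i=\mu(M_{i-1})$ for $i\geq 3$. Then for every $i\geq 5$, $D(M_i)\leq D(M_{i-1})$ and $D'(M_i)\leq D'(M_{i-1})$.
   Context: Graphs are finite, simple and undirected. For a graph $G$ with vertices $v_1,\dots,v_n$, the Mycielski graph $\mu(G)$ has vertex set $\{v_1,\dots,v_n,u_1,\dots,u_n,w\}$ and edge set consisting of the edges of $G$, the edges $wu_i$ for all $i$, and for every edge $v_iv_j$ of $G$ the two edges $u_iv_j$ and $v_iu_j$. The distinguishing number $D(H)$ is the least $r$ such that some vertex labeling of $H$ with $r$ labels is preserved only by the identity automorphism; the distinguishing index $D'(H)$ is the least $d$ such that some edge labeling of $H$ with $d$ labels is preserved only by the identity automorphism. -}

module Defs where

open import Data.Nat using (ℕ; zero; suc; _∸_; _≤_)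
open import Data.Fin using (Fin)
open import Data.Fin.Properties using () renaming (_≟_ to _≟ᶠ_)
open import Data.Bool using (Bool; true; false; not)
open import Data.Sum using (_⊎_; inj₁; inj₂)
open import Data.Unit using (⊤; tt)
open import Data.Product using (Σ; _×_)
open import Relation.Nullary.Decidable using (⌊_⌋)
open import Relation.Binary.PropositionalEquality using (_≡_)
open import Function.Bundles using (_↔_; Inverse)

record Graph : Set₁ where
  field
    V     : Set
    adj   : V → V → Bool
    sym   : ∀ x y → adj x y ≡ adj y x
    irref : ∀ x → adj x x ≡ false
open Graph public

K2 : Graph
K2 = record
  { V = Fin 2
  ; adj = λ x y → not ⌊ x ≟ᶠ y ⌋
  ; sym = symK
  ; irref = irrK }
  where
  symK : ∀ (x y : Fin 2) → not ⌊ x ≟ᶠ y ⌋ ≡ not ⌊ y ≟ᶠ x ⌋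
  symK Fin.zero Fin.zero = _≡_.refl
  symK Fin.zero (Fin.suc Fin.zero) = _≡_.refl
  symK (Fin.suc Fin.zero) Fin.zero = _≡_.refl
  symK (Fin.suc Fin.zero) (Fin.suc Fin.zero) = _≡_.refl
  irrK : ∀ (x : Fin 2) → not ⌊ x ≟ᶠ x ⌋ ≡ false
  irrK Fin.zero = _≡_.refl
  irrK (Fin.suc Fin.zero) = _≡_.refl

-- Mycielski graph: vertices  inj₁ v  (the v_i),  inj₂ (inj₁ v)  (the u_i),
-- inj₂ (inj₂ tt)  (the vertex w).
module _ (G : Graph) where
  private
    W : Set
    W = V G ⊎ (V G ⊎ ⊤)
    a = adj G

  μadj : W → W → Bool
  μadj (inj₁ x)        (inj₁ y)        = a x y
  μadj (inj₁ x)        (inj₂ (inj₁ y)) = a x y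
  μadj (inj₂ (inj₁ x)) (inj₁ y)        = a x y
  μadj (inj₂ (inj₁ x)) (inj₂ (inj₁ y)) = false
  μadj (inj₂ (inj₁ x)) (inj₂ (inj₂ _)) = true
  μadj (inj₂ (inj₂ _)) (inj₂ (inj₁ y)) = true
  μadj (inj₁ x)        (inj₂ (inj₂ _)) = false
  μadj (inj₂ (inj₂ _)) (inj₁ y)        = false
  μadj (inj₂ (inj₂ _)) (inj₂ (inj₂ _)) = false

  μsym : ∀ x y → μadj x y ≡ μadj y x
  μsym (inj₁ x)        (inj₁ y)        = sym G x y
  μsym (inj₁ x)        (inj₂ (inj₁ y)) = sym G x y
  μsym (inj₂ (inj₁ x)) (inj₁ y)        = sym G x y
  μsym (inj₂ (inj₁ x)) (inj₂ (inj₁ y)) = _≡_.refl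
  μsym (inj₂ (inj₁ x)) (inj₂ (inj₂ _)) = _≡_.refl
  μsym (inj₂ (inj₂ _)) (inj₂ (inj₁ y)) = _≡_.refl
  μsym (inj₁ x)        (inj₂ (inj₂ _)) = _≡_.refl
  μsym (inj₂ (inj₂ _)) (inj₁ y)        = _≡_.refl
  μsym (inj₂ (inj₂ _)) (inj₂ (inj₂ _)) = _≡_.refl

  μirr : ∀ x → μadj x x ≡ false
  μirr (inj₁ x) = irref G x
  μirr (inj₂ (inj₁ x)) = _≡_.refl
  μirr (inj₂ (inj₂ _)) = _≡_.refl

  mycielski : Graph
  mycielski = record { V = W ; adj = μadj ; sym = μsym ; irref = μirr }

-- M′ k = M_{k+2}
M′ : ℕ → Graph
M′ zero    = K2
M′ (suc k) = mycielski (M′ k)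

-- M i = M_i  (only meaningful for i ≥ 2; M 0 = M 1 = K₂ by convention)
M : ℕ → Graph
M i = M′ (i ∸ 2)

record Aut (G : Graph) : Set where
  field
    perm     : V G ↔ V G
    preserve : ∀ x y → adj G (Inverse.to perm x) (Inverse.to perm y) ≡ adj G x y
open Aut public

IsIdentity : {G : Graph} → Aut G → Set
IsIdentity {G} σ = ∀ x → Inverse.to (perm σ) x ≡ x

Distinguishing : (G : Graph) (r : ℕ) → (V G → Fin r) → Set
Distinguishing G r f =
  ∀ (σ : Aut G) → (∀ x → f (Inverse.to (perm σ) x) ≡ f x) → IsIdentity σ

IsDistNumber : Graph → ℕ → Set
IsDistNumber G r =
  Σ (V G → Fin r) (Distinguishing G r) ×
  (∀ s → Σ (V G → Fin s) (Distinguishing G s) → r ≤ s)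

record EdgeLabeling (G : Graph) (d : ℕ) : Set where
  field
    lab     : V G → V G → Fin d
    lab-sym : ∀ x y → adj G x y ≡ true → lab x y ≡ lab y x
open EdgeLabeling public

EdgeDistinguishing : (G : Graph) (d : ℕ) → EdgeLabeling G d → Set
EdgeDistinguishing G d ℓ =
  ∀ (σ : Aut G) →
  (∀ x y → adj G x y ≡ true →
     lab ℓ (Inverse.to (perm σ) x) (Inverse.to (perm σ) y) ≡ lab ℓ x y) →
  IsIdentity σ

IsDistIndex : Graph → ℕ → Set
IsDistIndex G d =
  Σ (EdgeLabeling G d) (EdgeDistinguishing G d) ×
  (∀ s → Σ (EdgeLabeling G s) (EdgeDistinguishing G s) → d ≤ s)

module Submission where

-- Let G be a finite graph of odd order n with no dominating vertex
-- (every degree is at most n - 2) and without twins (distinct vertices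
-- have distinct neighbourhoods).  In μ(G) the apex w has degree n, a base
-- vertex v_x has the even degree 2·deg x and a shadow u_x has degree
-- deg x + 1 < n; since automorphisms preserve degrees, every automorphism
-- σ of μ(G) fixes w.  It then maps base vertices (the non-neighbours of w
-- other than w) to base vertices, so it restricts to an automorphism of G,
-- and if that restriction is the identity then so is σ, because a shadow
-- u_x is determined by its base-neighbourhood N_G(x).  Consequently a
-- distinguishing vertex (edge) labelling of G extends to one of μ(G) by
-- giving u_x (the edges at u_x) the labels of v_x, so D(μ G) ≤ D(G) and
-- D'(μ G) ≤ D'(G).  Finally every M_j with j ≥ 3 is μ of a nonempty
-- twin-free graph, hence satisfies the three hypotheses.

open import Defs hiding (sym)
open import Data.Nat using (ℕ; zero; suc; _+_; _*_; _≤_; _<_; _∸_; z≤n; s≤s)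
open import Data.Nat.Properties
  using (+-assoc; +-comm; +-suc; +-identityʳ; +-mono-≤; +-monoˡ-≤; +-monoʳ-≤;
         ≤-trans; ≤-reflexive; m≤m+n; 1+n≰n; even≢odd; +-0-commutativeMonoid;
         module ≤-Reasoning)
open import Data.Nat.Tactic.RingSolver using (solve-∀)
open import Data.Fin using (Fin; zero; suc; _↑ˡ_; _↑ʳ_)
open import Data.Fin.Properties using (+↔⊎; 1↔⊤; splitAt-↑ˡ; splitAt-↑ʳ)
open import Data.Bool using (Bool; true; false)
open import Data.Sum using (_⊎_; inj₁; inj₂)
import Data.Sum as Sum
open import Data.Sum.Properties using (inj₁-injective)
open import Data.Sum.Function.Propositional using (_⊎-↔_)
open import Data.Unit using (⊤; tt)
open import Data.Product using (Σ; _×_; _,_; proj₁; proj₂)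
open import Function using (_∘_; _↔_; Inverse; mk↔ₛ′)
open import Function.Properties.Inverse using (↔-refl; ↔-sym; ↔-trans)
open import Relation.Binary.PropositionalEquality
  using (_≡_; _≗_; refl; sym; trans; cong; cong₂; subst; module ≡-Reasoning)
open import Relation.Nullary using (contradiction)
open import Algebra.Properties.CommutativeMonoid.Sum +-0-commutativeMonoid
  using (sum; sum-cong-≗; sum-permute; sum-replicate-zero)

sum-++ : ∀ a {b} (t : Fin (a + b) → ℕ) →
         sum t ≡ sum (t ∘ (_↑ˡ b)) + sum (t ∘ (a ↑ʳ_))
sum-++ zero    t = refl
sum-++ (suc a) t = trans (cong (t zero +_) (sum-++ a (t ∘ suc)))
                         (sym (+-assoc (t zero) _ _))

sum-ones : ∀ n → sum {n} (λ _ → 1) ≡ n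
sum-ones zero    = refl
sum-ones (suc n) = cong suc (sum-ones n)

boolToℕ : Bool → ℕ
boolToℕ true  = 1
boolToℕ false = 0

boolToℕ≤1 : ∀ b → boolToℕ b ≤ 1
boolToℕ≤1 true  = s≤s z≤n
boolToℕ≤1 false = z≤n

sum-indicator≤ : ∀ {n} (p : Fin n → Bool) → sum (boolToℕ ∘ p) ≤ n
sum-indicator≤ {zero}  p = z≤n
sum-indicator≤ {suc n} p = +-mono-≤ (boolToℕ≤1 (p zero)) (sum-indicator≤ (p ∘ suc))

sum-indicator< : ∀ {n} (p : Fin n → Bool) (i : Fin n) → p i ≡ false →
                 sum (boolToℕ ∘ p) < n
sum-indicator< p zero    pᵢ≡false rewrite pᵢ≡false = s≤s (sum-indicator≤ (p ∘ suc))
sum-indicator< {suc n} p (suc i) pᵢ≡false =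
  subst (_≤ suc n) (+-suc (boolToℕ (p zero)) (sum (boolToℕ ∘ p ∘ suc)))
        (+-mono-≤ (boolToℕ≤1 (p zero)) (sum-indicator< (p ∘ suc) i pᵢ≡false))

record Finite (A : Set) : Set where
  field
    size : ℕ
    enum : Fin size ↔ A
open Finite

count : {A : Set} → Finite A → (A → ℕ) → ℕ
count F h = sum (h ∘ Inverse.to (enum F))

count-cong : {A : Set} (F : Finite A) {h h′ : A → ℕ} → h ≗ h′ → count F h ≡ count F h′
count-cong F h≗h′ = sum-cong-≗ (h≗h′ ∘ Inverse.to (enum F))

count-reindex : {A : Set} (F : Finite A) (π : A ↔ A) (h : A → ℕ) →
                count F h ≡ count F (h ∘ Inverse.to π)
count-reindex {A} F π h =
  trans (sum-permute (h ∘ e) ρ)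
        (sum-cong-≗ λ i → cong h (Inverse.strictlyInverseˡ (enum F) (Inverse.to π (e i))))
  where
  e : Fin (size F) → A
  e = Inverse.to (enum F)
  ρ : Fin (size F) ↔ Fin (size F)
  ρ = ↔-trans (enum F) (↔-trans π (↔-sym (enum F)))

count-zero : {A : Set} (F : Finite A) → count F (λ _ → 0) ≡ 0
count-zero F = sum-replicate-zero (size F)

count-one : {A : Set} (F : Finite A) → count F (λ _ → 1) ≡ size F
count-one F = sum-ones (size F)

count-indicator< : {A : Set} (F : Finite A) (p : A → Bool) (a : A) → p a ≡ false →
                   count F (boolToℕ ∘ p) < size F
count-indicator< F p a pa≡false =
  sum-indicator< (p ∘ Inverse.to (enum F)) (Inverse.from (enum F) a)
    (trans (cong p (Inverse.strictlyInverseˡ (enum F) a)) pa≡false)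

finite-Fin : ∀ n → Finite (Fin n)
finite-Fin n = record { size = n ; enum = ↔-refl }

finite-⊤ : Finite ⊤
finite-⊤ = record { size = 1 ; enum = 1↔⊤ }

_⊎ᶠ_ : {A B : Set} → Finite A → Finite B → Finite (A ⊎ B)
FA ⊎ᶠ FB = record { size = size FA + size FB ; enum = ↔-trans +↔⊎ (enum FA ⊎-↔ enum FB) }

count-⊎ : {A B : Set} (FA : Finite A) (FB : Finite B) (h : A ⊎ B → ℕ) →
          count (FA ⊎ᶠ FB) h ≡ count FA (h ∘ inj₁) + count FB (h ∘ inj₂)
count-⊎ FA FB h =
  trans (sum-++ (size FA) _)
        (cong₂ _+_ (sum-cong-≗ λ i → cong h′ (splitAt-↑ˡ (size FA) i (size FB)))
                   (sum-cong-≗ λ i → cong h′ (splitAt-↑ʳ (size FA) (size FB) i)))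
  where
  h′ : Fin (size FA) ⊎ Fin (size FB) → ℕ
  h′ = h ∘ Sum.map (Inverse.to (enum FA)) (Inverse.to (enum FB))

degree : (G : Graph) → Finite (V G) → V G → ℕ
degree G F x = count F (boolToℕ ∘ adj G x)

degree<order : (G : Graph) (F : Finite (V G)) (x : V G) → degree G F x < size F
degree<order G F x = count-indicator< F (adj G x) x (irref G x)

act : {G : Graph} → Aut G → V G → V G
act σ = Inverse.to (perm σ)

act-injective : {G : Graph} (σ : Aut G) {x y : V G} → act σ x ≡ act σ y → x ≡ y
act-injective σ {x} {y} σx≡σy =
  trans (sym (Inverse.strictlyInverseʳ (perm σ) x))
        (trans (cong (Inverse.from (perm σ)) σx≡σy) (Inverse.strictlyInverseʳ (perm σ) y))

inverseAut : {G : Graph} → Aut G → Aut G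
inverseAut {G} σ = record
  { perm     = ↔-sym (perm σ)
  ; preserve = λ x y → trans (sym (preserve σ (σ⁻¹ x) (σ⁻¹ y)))
                             (cong₂ (adj G) (Inverse.strictlyInverseˡ (perm σ) x)
                                            (Inverse.strictlyInverseˡ (perm σ) y))
  }
  where
  σ⁻¹ : V G → V G
  σ⁻¹ = Inverse.from (perm σ)

degree-invariant : (G : Graph) (F : Finite (V G)) (σ : Aut G) (x : V G) →
                   degree G F (act σ x) ≡ degree G F x
degree-invariant G F σ x =
  trans (count-reindex F (perm σ) (boolToℕ ∘ adj G (act σ x)))
        (count-cong F (cong boolToℕ ∘ preserve σ x))

TwinFree : Graph → Set
TwinFree G = ∀ x y → (∀ z → adj G x z ≡ adj G y z) → x ≡ y

NoDominatingVertex : (G : Graph) → Finite (V G) → Set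
NoDominatingVertex G F = ∀ x → 2 + degree G F x ≤ size F

OddOrder : {A : Set} → Finite A → Set
OddOrder F = Σ ℕ λ m → size F ≡ suc (2 * m)

pattern base x   = inj₁ x
pattern shadow x = inj₂ (inj₁ x)
pattern apex     = inj₂ (inj₂ tt)

finite-μ : {G : Graph} → Finite (V G) → Finite (V (mycielski G))
finite-μ F = F ⊎ᶠ (F ⊎ᶠ finite-⊤)

μ-oddOrder : {G : Graph} (F : Finite (V G)) → OddOrder (finite-μ {G} F)
μ-oddOrder F = n , trans (cong (n +_) (+-suc n 0)) (+-suc n (n + 0))
  where
  n : ℕ
  n = size F

count-μ : {G : Graph} (F : Finite (V G)) (h : V (mycielski G) → ℕ) →
          count (finite-μ {G} F) h ≡ count F (h ∘ base) + (count F (h ∘ shadow) + (h apex + 0))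
count-μ F h = trans (count-⊎ F (F ⊎ᶠ finite-⊤) h)
                    (cong (count F (h ∘ base) +_) (count-⊎ F finite-⊤ (h ∘ inj₂)))

module MycielskiDegrees (G : Graph) (F : Finite (V G)) where

  degreeμ : V (mycielski G) → ℕ
  degreeμ = degree (mycielski G) (finite-μ {G} F)

  -- v_x is adjacent to v_y and u_y for every neighbour y of x.
  degree-base : ∀ x → degreeμ (base x) ≡ 2 * degree G F x
  degree-base x = count-μ {G} F (boolToℕ ∘ μadj G (base x))

  -- u_x is adjacent to v_y for every neighbour y of x, and to w.
  degree-shadow : ∀ x → degreeμ (shadow x) ≡ degree G F x + 1
  degree-shadow x = trans (count-μ {G} F (boolToℕ ∘ μadj G (shadow x)))
                          (cong (λ c → degree G F x + (c + 1)) (count-zero F))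

  -- w is adjacent to exactly the n shadows.
  degree-apex : degreeμ apex ≡ size F
  degree-apex = begin
    degreeμ apex                             ≡⟨ count-μ {G} F (boolToℕ ∘ μadj G apex) ⟩
    count F (λ _ → 0) + (count F (λ _ → 1) + 0) ≡⟨ cong₂ (λ a b → a + (b + 0)) (count-zero F) (count-one F) ⟩
    size F + 0                               ≡⟨ +-identityʳ (size F) ⟩
    size F                                   ∎
    where open ≡-Reasoning

module RigidMycielski (G : Graph) (F : Finite (V G)) (oddOrder : OddOrder F)
                      (noDominating : NoDominatingVertex G F) (twinFree : TwinFree G) where

  open MycielskiDegrees G F

  -- Only w has degree n: v_x has even degree, u_x has degree at most n - 1.
  apex-fixed : (σ : Aut (mycielski G)) → act σ apex ≡ apex
  apex-fixed σ with act σ apex in σw≡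
  ... | apex     = refl
  ... | base x   = contradiction 2d≡n+1 (even≢odd (degree G F x) (proj₁ oddOrder))
    where
    open ≡-Reasoning
    2d≡n+1 : 2 * degree G F x ≡ suc (2 * proj₁ oddOrder)
    2d≡n+1 = begin
      2 * degree G F x       ≡⟨ sym (degree-base x) ⟩
      degreeμ (base x)       ≡⟨ cong degreeμ (sym σw≡) ⟩
      degreeμ (act σ apex)   ≡⟨ degree-invariant (mycielski G) (finite-μ {G} F) σ apex ⟩
      degreeμ apex           ≡⟨ degree-apex ⟩
      size F                 ≡⟨ proj₂ oddOrder ⟩
      suc (2 * proj₁ oddOrder) ∎
  ... | shadow x = contradiction (≤-trans (noDominating x) (≤-reflexive n≡1+d)) 1+n≰n
    where
    open ≡-Reasoning
    n≡1+d : size F ≡ 1 + degree G F x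
    n≡1+d = begin
      size F                 ≡⟨ sym degree-apex ⟩
      degreeμ apex           ≡⟨ sym (degree-invariant (mycielski G) (finite-μ {G} F) σ apex) ⟩
      degreeμ (act σ apex)   ≡⟨ cong degreeμ σw≡ ⟩
      degreeμ (shadow x)     ≡⟨ degree-shadow x ⟩
      degree G F x + 1       ≡⟨ +-comm (degree G F x) 1 ⟩
      1 + degree G F x       ∎

  -- An automorphism fixing w maps base vertices (the non-neighbours of w
  -- other than w itself) to base vertices.
  base-preserved : (τ : Aut (mycielski G)) → act τ apex ≡ apex →
                   ∀ x → Σ (V G) λ y → act τ (base x) ≡ base y
  base-preserved τ τw≡w x with act τ (base x) in τv≡
  ... | base y   = y , refl
  ... | shadow y = contradiction (trans (sym (preserve τ apex (base x))) (cong₂ (μadj G) τw≡w τv≡))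
                                 λ ()
  ... | apex     = contradiction (act-injective τ (trans τv≡ (sym τw≡w))) λ ()

  restrictMap : Aut (mycielski G) → V G → V G
  restrictMap σ x = proj₁ (base-preserved σ (apex-fixed σ) x)

  restrictMap-base : (σ : Aut (mycielski G)) (x : V G) → act σ (base x) ≡ base (restrictMap σ x)
  restrictMap-base σ x = proj₂ (base-preserved σ (apex-fixed σ) x)

  restrict : Aut (mycielski G) → Aut G
  restrict σ = record
    { perm     = mk↔ₛ′ (restrictMap σ) (restrictMap σ⁻¹) (cancel σ σ⁻¹ σσ⁻¹) (cancel σ⁻¹ σ σ⁻¹σ)
    ; preserve = λ x y → trans (sym (cong₂ (μadj G) (restrictMap-base σ x) (restrictMap-base σ y)))
                               (preserve σ (base x) (base y))
    }
    where
    σ⁻¹ : Aut (mycielski G)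
    σ⁻¹ = inverseAut σ
    σσ⁻¹ : ∀ v → act σ (act σ⁻¹ v) ≡ v
    σσ⁻¹ = Inverse.strictlyInverseˡ (perm σ)
    σ⁻¹σ : ∀ v → act σ⁻¹ (act σ v) ≡ v
    σ⁻¹σ = Inverse.strictlyInverseʳ (perm σ)
    cancel : ∀ ρ ρ′ → (∀ v → act ρ (act ρ′ v) ≡ v) → ∀ y → restrictMap ρ (restrictMap ρ′ y) ≡ y
    cancel ρ ρ′ ρρ′ y = inj₁-injective (begin
      base (restrictMap ρ (restrictMap ρ′ y)) ≡⟨ sym (restrictMap-base ρ _) ⟩
      act ρ (base (restrictMap ρ′ y))         ≡⟨ cong (act ρ) (sym (restrictMap-base ρ′ y)) ⟩
      act ρ (act ρ′ (base y))                 ≡⟨ ρρ′ (base y) ⟩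
      base y                                  ∎)
      where open ≡-Reasoning

  -- An automorphism fixing every base vertex is the identity: the shadow
  -- u_x is the unique shadow whose base-neighbourhood is N_G(x).
  fixes-base⇒identity : (σ : Aut (mycielski G)) → (∀ x → act σ (base x) ≡ base x) → IsIdentity σ
  fixes-base⇒identity σ fixed (base x) = fixed x
  fixes-base⇒identity σ fixed apex     = apex-fixed σ
  fixes-base⇒identity σ fixed (shadow x) with act σ (shadow x) in σu≡
  ... | shadow y = cong shadow (twinFree y x λ z →
          trans (sym (cong₂ (μadj G) σu≡ (fixed z))) (preserve σ (shadow x) (base z)))
  ... | base y   = contradiction (trans (sym (cong₂ (μadj G) (apex-fixed σ) σu≡))
                                        (preserve σ apex (shadow x))) λ ()
  ... | apex     = contradiction (act-injective σ (trans σu≡ (sym (apex-fixed σ)))) λ ()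

  restrict-identity⇒identity : (σ : Aut (mycielski G)) → IsIdentity (restrict σ) → IsIdentity σ
  restrict-identity⇒identity σ id-restrict =
    fixes-base⇒identity σ λ x → trans (restrictMap-base σ x) (cong base (id-restrict x))

  -- G has odd, hence positive, order; its label is reused at the apex.
  someVertex : V G
  someVertex = Inverse.to (enum F) (subst Fin (sym (proj₂ oddOrder)) zero)

  liftLabeling : ∀ {s} → (V G → Fin s) → V (mycielski G) → Fin s
  liftLabeling f (base x)   = f x
  liftLabeling f (shadow x) = f x
  liftLabeling f apex       = f someVertex

  liftLabeling-distinguishing : ∀ {s} (f : V G → Fin s) → Distinguishing G s f →
                                Distinguishing (mycielski G) s (liftLabeling f)
  liftLabeling-distinguishing f distinguishing σ keeps =
    restrict-identity⇒identity σ (distinguishing (restrict σ) λ x →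
      trans (sym (cong (liftLabeling f) (restrictMap-base σ x))) (keeps (base x)))

  liftEdgeLabeling : ∀ {s} → EdgeLabeling G s → EdgeLabeling (mycielski G) s
  liftEdgeLabeling {s} ℓ = record { lab = lab′ ; lab-sym = lab′-sym }
    where
    lab′ : V (mycielski G) → V (mycielski G) → Fin s
    lab′ (base x)   (base y)   = lab ℓ x y
    lab′ (base x)   (shadow y) = lab ℓ x y
    lab′ (shadow x) (base y)   = lab ℓ x y
    lab′ _          _          = lab ℓ someVertex someVertex
    lab′-sym : ∀ x y → μadj G x y ≡ true → lab′ x y ≡ lab′ y x
    lab′-sym (base x)   (base y)   xy = lab-sym ℓ x y xy
    lab′-sym (base x)   (shadow y) xy = lab-sym ℓ x y xy
    lab′-sym (shadow x) (base y)   xy = lab-sym ℓ x y xy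
    lab′-sym (shadow x) apex       xy = refl
    lab′-sym apex       (shadow y) xy = refl

  liftEdgeLabeling-distinguishing : ∀ {s} (ℓ : EdgeLabeling G s) → EdgeDistinguishing G s ℓ →
                                    EdgeDistinguishing (mycielski G) s (liftEdgeLabeling ℓ)
  liftEdgeLabeling-distinguishing ℓ distinguishing σ keeps =
    restrict-identity⇒identity σ (distinguishing (restrict σ) λ x y xy →
      trans (sym (cong₂ (lab (liftEdgeLabeling ℓ)) (restrictMap-base σ x) (restrictMap-base σ y)))
            (keeps (base x) (base y) xy))

  distNumber-μ≤ : ∀ r s → IsDistNumber (mycielski G) r → IsDistNumber G s → r ≤ s
  distNumber-μ≤ r s (_ , minimal) ((f , distinguishing) , _) =
    minimal s (liftLabeling f , liftLabeling-distinguishing f distinguishing)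

  distIndex-μ≤ : ∀ r s → IsDistIndex (mycielski G) r → IsDistIndex G s → r ≤ s
  distIndex-μ≤ r s (_ , minimal) ((ℓ , distinguishing) , _) =
    minimal s (liftEdgeLabeling ℓ , liftEdgeLabeling-distinguishing ℓ distinguishing)

-- μ(G) is twin-free whenever G is: w separates base vertices from shadows,
-- u_x separates v_x from w, and within the base vertices (or the shadows)
-- the neighbourhood among base vertices is N_G(x), which determines x.
twinFree-μ : (G : Graph) → TwinFree G → TwinFree (mycielski G)
twinFree-μ G twinFree (base x)   (base y)   same = cong base (twinFree x y (same ∘ base))
twinFree-μ G twinFree (shadow x) (shadow y) same = cong shadow (twinFree x y (same ∘ base))
twinFree-μ G twinFree (base x)   (shadow y) same = contradiction (same apex) λ ()
twinFree-μ G twinFree (shadow x) (base y)   same = contradiction (same apex) λ ()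
twinFree-μ G twinFree (base x)   apex       same =
  contradiction (trans (sym (irref G x)) (same (shadow x))) λ ()
twinFree-μ G twinFree apex       (base y)   same =
  contradiction (trans (same (shadow y)) (irref G y)) λ ()
twinFree-μ G twinFree (shadow x) apex       same = contradiction (same (shadow x)) λ ()
twinFree-μ G twinFree apex       (shadow y) same = contradiction (same (shadow y)) λ ()
twinFree-μ G twinFree apex       apex       same = refl

twinFree-K2 : TwinFree K2
twinFree-K2 zero       zero       same = refl
twinFree-K2 zero       (suc zero) same = contradiction (same zero) λ ()
twinFree-K2 (suc zero) zero       same = contradiction (same zero) λ ()
twinFree-K2 (suc zero) (suc zero) same = refl

twinFree-M′ : ∀ k → TwinFree (M′ k)
twinFree-M′ zero    = twinFree-K2
twinFree-M′ (suc k) = twinFree-μ (M′ k) (twinFree-M′ k)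

finite-M′ : ∀ k → Finite (V (M′ k))
finite-M′ zero    = finite-Fin 2
finite-M′ (suc k) = finite-μ {M′ k} (finite-M′ k)

vertex-M′ : ∀ k → V (M′ k)
vertex-M′ zero    = zero
vertex-M′ (suc k) = apex

-- μ(G) has no dominating vertex as soon as G has a vertex: with n = |G|
-- and d = deg_G x < n, the degrees 2d, d + 1 and n are all at most 2n - 1.
μ-noDominating : (G : Graph) (F : Finite (V G)) → V G →
                 NoDominatingVertex (mycielski G) (finite-μ {G} F)
μ-noDominating G F x₀ = bound
  where
  open MycielskiDegrees G F
  open ≤-Reasoning
  n : ℕ
  n = size F

  n≥1 : 1 ≤ n
  n≥1 = ≤-trans (s≤s z≤n) (degree<order G F x₀)

  2≤n+1 : 2 ≤ n + 1
  2≤n+1 = +-monoˡ-≤ 1 n≥1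

  2+2d≡ : ∀ d → 2 + 2 * d ≡ suc d + suc d
  2+2d≡ = solve-∀

  2+[d+1]≡ : ∀ d → 2 + (d + 1) ≡ suc d + 2
  2+[d+1]≡ = solve-∀

  bound : NoDominatingVertex (mycielski G) (finite-μ {G} F)
  bound (base x) = begin
    2 + degreeμ (base x)      ≡⟨ cong (2 +_) (degree-base x) ⟩
    2 + 2 * degree G F x      ≡⟨ 2+2d≡ (degree G F x) ⟩
    suc (degree G F x) + suc (degree G F x)
                              ≤⟨ +-mono-≤ (degree<order G F x) (degree<order G F x) ⟩
    n + n                     ≤⟨ +-monoʳ-≤ n (m≤m+n n 1) ⟩
    n + (n + 1)               ∎
  bound (shadow x) = begin
    2 + degreeμ (shadow x)    ≡⟨ cong (2 +_) (degree-shadow x) ⟩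
    2 + (degree G F x + 1)    ≡⟨ 2+[d+1]≡ (degree G F x) ⟩
    suc (degree G F x) + 2    ≤⟨ +-mono-≤ (degree<order G F x) 2≤n+1 ⟩
    n + (n + 1)               ∎
  bound apex = begin
    2 + degreeμ apex          ≡⟨ cong (2 +_) degree-apex ⟩
    2 + n                     ≡⟨ +-comm 2 n ⟩
    n + 2                     ≤⟨ +-monoʳ-≤ n 2≤n+1 ⟩
    n + (n + 1)               ∎

module MycielskiFamilyStep (k : ℕ) =
  RigidMycielski (M′ (suc k)) (finite-M′ (suc k)) (μ-oddOrder {M′ k} (finite-M′ k))
                 (μ-noDominating (M′ k) (finite-M′ k) (vertex-M′ k)) (twinFree-M′ (suc k))

mainTheorem14 : ∀ (i : ℕ) → 5 ≤ i →
    (∀ r s → IsDistNumber (M i) r → IsDistNumber (M (i ∸ 1)) s → r ≤ s) ×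
    (∀ r s → IsDistIndex (M i) r → IsDistIndex (M (i ∸ 1)) s → r ≤ s)
mainTheorem14 (suc (suc (suc (suc (suc j))))) (s≤s (s≤s (s≤s (s≤s (s≤s _))))) =
  distNumber-μ≤ , distIndex-μ≤
  where
  -- M_{j+5} = μ(M_{j+4}) and M_{j+4} = M′ (suc (suc j)).
  open MycielskiFamilyStep (suc j)
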